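{- Let $f\colon\mathbb{B}^n\to\mathbb{B}^n$ be a Boolean network with set of components $V$, and let $v\in V$ be such that there is no positive loop at $v$ in $G(f)$. Let $\mathcal{R}^0,\mathcal{R}^1,\mathcal{S}^0,\mathcal{S}^1,\pi,\tilde f$ be as in the context. Then: (i) For each $x\in\mathbb{B}^n$ such that $x\neq\mathcal{R}^0(x)$ or $x\neq\mathcal{R}^1(x)$, there is a transition in $AD(f)$ from $x$ to $\mathcal{R}^0(x)$ or to $\mathcal{R}^1(x)$, and the set $\{\mathcal{R}^0(x),\mathcal{R}^1(x)\}$ is strongly connected in $AD(f)$. (ii) For all $x\in\mathbb{B}^n$ and $a\in\{0,1\}$, if $\mathcal{R}^a(x)\to y$ is a transition in $AD(f)$ in direction $i\in V\setminus\{v\}$, then $\pi(x)=\pi(\mathcal{R}^a(x))\to\pi(\bar{x}^i)$ is a transition in $AD(\tilde f)$. (iii) For each $x\in\mathbb{B}^n$ and $i\in V\setminus\{v\}$ such that there is no edge from $v$ to $i$ in $G(f)$, if $x\to\bar{x}^i$ is a transition in $AD(f)$, then $\mathcal{R}^a(x)\to\overline{\mathcal{R}^a(x)}^i$ is a transition in $AD(f)$ for $a=0,1$, and $\pi(x)\to\pi(\bar{x}^i)$ is a transition in $AD(\tilde f)$. (iv) If $x\in\mathbb{B}^{n-1}$ and $x\to\bar{x}^i$ is a transition in $AD(\tilde f)$, then there exists $a\in\{0,1\}$ such that $\mathcal{S}^a(x)\to\overline{\mathcal{S}^a(x)}^i$ is a transition in $AD(f)$; moreover, from each $y\in\pi^{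 -1}(x)$ there exists a path in $AD(f)$ to $\overline{\mathcal{S}^a(x)}^i$.
   Context: $\mathbb{B}=\{0,1\}$. A Boolean network is a map $f\colon\mathbb{B}^n\to\mathbb{B}^n$ with set of components $V=\{1,\dots,n\}$. For $x\in\mathbb{B}^n$ and $I\subseteq V$, $\bar{x}^I$ is the state with $\bar{x}^I_i=1-x_i$ for $i\in I$ and $\bar{x}^I_i=x_i$ otherwise; $\bar{x}^i=\bar{x}^{\{i\}}$; for $a\in\mathbb{B}$, $x^{i=a}$ is $x$ with $i$-th component set to $a$. The asynchronous dynamics $AD(f)$ is the directed graph on $\mathbb{B}^n$ with a transition $x\to\bar{x}^i$ (in direction $i$) iff $f_i(x)\neq x_i$. The local interaction graph $G(f)(x)$ is the signed directed graph on $V$ with an edge $j\to i$ of sign $s\in\{ -1,1\}$ iff $s=(f_i(\bar{x}^j)-f_i(x))(\bar{x}^j_j-x_j)$; the interaction graph $G(f)$ is the union over all $x$ of the $G(f)(x)$ (a signed multidigraph). A loop is an edge $i\to i$; a positive (negative) loop at $v$ is a loop of sign $+1$ ($-1$). A set of states is strongly connected if each of its states can reach each other one by a path of transitions inside it. Elimination of $v$: assume no positive loop at $v$ in $G(f)$. For $a\in\{0,1\}$ let $\mathcal{R}^a\colon\mathbb{B}^n\to\mathbb{B}^n$, $\mathcal{R}^a(x)=(x_1,\dots,x_{v-1},f_v(x^{v=a}),x_{v+1},\dots,x_n)$. Let $\pi\colon\mathbb{B}^n\to\mathbb{B}^{n-1}$ be the projection onto the components $V\setminus\{v\}$ (states of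 $\mathbb{B}^{n-1}$ and components of $\tilde f$ are indexed by $V\setminus\{v\}$). Let $\mathcal{S}^a\colon\mathbb{B}^{n-1}\to\mathbb{B}^n$ be the unique maps with $\mathcal{S}^a\circ\pi=\mathcal{R}^a$. The reduced network $\tilde f\colon\mathbb{B}^{n-1}\to\mathbb{B}^{n-1}$ is defined for $i\in V\setminus\{v\}$ by $\tilde f_i(x)=f_i(\mathcal{S}^0(x))\wedge f_i(\mathcal{S}^1(x))$ if $x_i=1$ and $\tilde f_i(x)=f_i(\mathcal{S}^0(x))\vee f_i(\mathcal{S}^1(x))$ if $x_i=0$. -}

module Defs where

open import Data.Bool using (Bool; true; false; not; _∧_; _∨_; if_then_else_)
open import Data.Nat using (ℕ; suc)
open import Data.Fin using (Fin; punchIn)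
open import Data.Vec using (Vec; lookup; updateAt; insertAt; removeAt; tabulate; _[_]≔_)
open import Data.Integer using (ℤ; +_; -_; _-_; _*_)
open import Data.Product using (Σ; _×_)
open import Data.Sum using (_⊎_)
open import Relation.Binary.PropositionalEquality using (_≡_; _≢_)
open import Relation.Binary.Construct.Closure.ReflexiveTransitive using (Star)

State : ℕ → Set
State n = Vec Bool n

BN : ℕ → Set
BN n = State n → State n

flip : ∀ {n} → State n → Fin n → State n
flip x i = updateAt x i not

setAt : ∀ {n} → State n → Fin n → Bool → State n
setAt x i a = x [ i ]≔ a

TransIn : ∀ {n} → BN n → State n → State n → Fin n → Set
TransIn f x y i = (lookup (f x) i ≢ lookup x i) × (y ≡ flip x i)

Trans : ∀ {n} → BN n → State n → State n → Set
Trans f x y = Σ (Fin _) (λ i → TransIn f x y i)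

Path : ∀ {n} → BN n → State n → State n → Set
Path f = Star (Trans f)

TransWithin : ∀ {n} → BN n → (State n → Set) → State n → State n → Set
TransWithin f P x y = P x × P y × Trans f x y

StronglyConnected : ∀ {n} → BN n → (State n → Set) → Set
StronglyConnected f P = ∀ x y → P x → P y → Star (TransWithin f P) x y

toℤ : Bool → ℤ
toℤ false = + 0
toℤ true  = + 1

signAt : ∀ {n} → BN n → State n → Fin n → Fin n → ℤ
signAt f x j i =
  (toℤ (lookup (f (flip x j)) i) - toℤ (lookup (f x) i))
    * (toℤ (lookup (flip x j) j) - toℤ (lookup x j))

IsSign : ℤ → Set
IsSign s = (s ≡ + 1) ⊎ (s ≡ - (+ 1))

LocalEdge : ∀ {n} → BN n → State n → Fin n → Fin n → ℤ → Set
LocalEdge f x j i s = IsSign s × (s ≡ signAt f x j i)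

Edge : ∀ {n} → BN n → Fin n → Fin n → ℤ → Set
Edge f j i s = Σ (State _) (λ x → LocalEdge f x j i s)

HasEdge : ∀ {n} → BN n → Fin n → Fin n → Set
HasEdge f j i = Σ ℤ (λ s → Edge f j i s)

PositiveLoop : ∀ {n} → BN n → Fin n → Set
PositiveLoop f v = Edge f v v (+ 1)

-- Elimination of v.  V = Fin (suc n); V ∖ {v} is indexed by Fin n,
-- reduced component i ∈ Fin n corresponding to component punchIn v i.

R : ∀ {n} → BN (suc n) → Fin (suc n) → Bool → State (suc n) → State (suc n)
R f v a x = setAt x v (lookup (f (setAt x v a)) v)

proj : ∀ {n} → Fin (suc n) → State (suc n) → State n
proj v x = removeAt x v

-- 𝓢^a : the unique map with 𝓢^a ∘ π = 𝓡^a
S : ∀ {n} → BN (suc n) → Fin (suc n) → Bool → State n → State (suc n)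
S f v a x = insertAt x v (lookup (f (insertAt x v a)) v)

reduce : ∀ {n} → BN (suc n) → Fin (suc n) → BN n
reduce f v x = tabulate λ i →
  if lookup x i
    then lookup (f (S f v false x)) (punchIn v i) ∧ lookup (f (S f v true x)) (punchIn v i)
    else lookup (f (S f v false x)) (punchIn v i) ∨ lookup (f (S f v true x)) (punchIn v i)

{-# OPTIONS --safe #-}
module Submission where

-- Write a state as x = z ⊕ᵥ b with z = π x and b = x_v. Then 𝓡^a x = 𝓢^a z = z ⊕ᵥ g_z(a) with
-- g_z(a) = f_v(z ⊕ᵥ a), and a positive loop at v is exactly a z for which g_z is the identity.
-- Otherwise g_z is constant or negation, so from z ⊕ᵥ b at most one step in direction v reaches
-- z ⊕ᵥ g_z(a): this gives (i) and the paths of (iv). The reduced component f̃_i moves x_i iff f_i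
-- does at 𝓢^0 z or at 𝓢^1 z, giving (ii) and (iv); with no edge v → i, f_i ignores x_v, giving (iii).

open import Defs
open import Data.Bool using (Bool; false; true; not; _∧_; _∨_; if_then_else_)
open import Data.Bool.Properties using (_≟_; ¬-not; not-¬)
open import Data.Nat using (suc)
open import Data.Fin using (Fin; punchIn; zero; suc)
open import Data.Fin.Properties using () renaming (_≟_ to _≟ᶠ_)
open import Data.Vec using (Vec; _∷_; lookup; updateAt; insertAt; removeAt)
open import Data.Vec.Properties
  using (insertAt-lookup; insertAt-punchIn; removeAt-insertAt; insertAt-removeAt;
         lookup∘updateAt; lookup∘updateAt′; lookup∘tabulate)
open import Data.Integer using (+_; _-_; _*_)
open import Data.Product using (Σ; _×_; _,_)
open import Data.Sum using (_⊎_; inj₁; inj₂)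
open import Data.Empty using (⊥-elim)
open import Relation.Nullary using (¬_; yes; no)
open import Relation.Binary.PropositionalEquality
  using (_≡_; _≢_; refl; sym; trans; cong; subst; ≢-sym)
open import Relation.Binary.Construct.Closure.ReflexiveTransitive using (Star; ε; _◅_; _◅◅_)

updateAt-insertAt : ∀ {A : Set} {n} (xs : Vec A n) i x (h : A → A) →
  updateAt (insertAt xs i x) i h ≡ insertAt xs i (h x)
updateAt-insertAt xs       zero    x h = refl
updateAt-insertAt (y ∷ xs) (suc i) x h = cong (y ∷_) (updateAt-insertAt xs i x h)

updateAt-insertAt-punchIn : ∀ {A : Set} {n} (xs : Vec A n) i x j (h : A → A) →
  updateAt (insertAt xs i x) (punchIn i j) h ≡ insertAt (updateAt xs j h) i x
updateAt-insertAt-punchIn xs       zero    x j       h = refl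
updateAt-insertAt-punchIn (y ∷ xs) (suc i) x zero    h = refl
updateAt-insertAt-punchIn (y ∷ xs) (suc i) x (suc j) h =
  cong (y ∷_) (updateAt-insertAt-punchIn xs i x j h)

flip-injective : ∀ {n} (x : State n) {i j} → flip x i ≡ flip x j → i ≡ j
flip-injective x {i} {j} e with i ≟ᶠ j
... | yes i≡j = i≡j
... | no  i≢j = ⊥-elim (not-¬ refl (sym xᵢ-flipped))
  where
  xᵢ-flipped : not (lookup x i) ≡ lookup x i
  xᵢ-flipped = trans (sym (lookup∘updateAt i x))
                     (trans (cong (λ y → lookup y i) e) (lookup∘updateAt′ i j i≢j x))

Flips : ∀ {n} → BN n → State n → Fin n → Set
Flips f x i = lookup (f x) i ≢ lookup x i

flips-transition : ∀ {n} (f : BN n) {x : State n} {i} → Flips f x i → Trans f x (flip x i)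
flips-transition f {i = i} fl = i , fl , refl

transition-flips : ∀ {n} (f : BN n) {x : State n} {i} → Trans f x (flip x i) → Flips f x i
transition-flips f {x} (j , fl , e) = subst (Flips f x) (sym (flip-injective x e)) fl

differing-sign : ∀ {p q b′ b} → p ≢ q → b′ ≡ not b →
  IsSign ((toℤ p - toℤ q) * (toℤ b′ - toℤ b))
differing-sign {false} {false} p≢q _    = ⊥-elim (p≢q refl)
differing-sign {true}  {true}  p≢q _    = ⊥-elim (p≢q refl)
differing-sign {false} {true}  {b = false} _ refl = inj₂ refl
differing-sign {false} {true}  {b = true}  _ refl = inj₁ refl
differing-sign {true}  {false} {b = false} _ refl = inj₁ refl
differing-sign {true}  {false} {b = true}  _ refl = inj₂ refl

¬HasEdge⇒flip-invariant : ∀ {n} (f : BN n) {j i} → ¬ HasEdge f j i →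
  ∀ x → lookup (f (flip x j)) i ≡ lookup (f x) i
¬HasEdge⇒flip-invariant f {j} {i} noEdge x with lookup (f (flip x j)) i ≟ lookup (f x) i
... | yes same = same
... | no  differ =
  ⊥-elim (noEdge (signAt f x j i , x , differing-sign differ (lookup∘updateAt j x) , refl))

flip-reaches-image : (g : Bool → Bool) → ¬ (g false ≡ false × g true ≡ true) →
  ∀ b a → b ≢ g a → g b ≢ b × not b ≡ g a
flip-reaches-image g _ false false b≢ga = ≢-sym b≢ga , sym (¬-not (≢-sym b≢ga))
flip-reaches-image g _ true  true  b≢ga = ≢-sym b≢ga , sym (¬-not (≢-sym b≢ga))
flip-reaches-image g g≢id false true b≢ga with g false | g true
... | _     | false = ⊥-elim (b≢ga refl)
... | false | true  = ⊥-elim (g≢id (refl , refl))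
... | true  | true  = (λ ()) , refl
flip-reaches-image g g≢id true false b≢ga with g false | g true
... | true  | _     = ⊥-elim (b≢ga refl)
... | false | true  = ⊥-elim (g≢id (refl , refl))
... | false | false = (λ ()) , refl

∧∨-flips-one : ∀ c p q → (if c then p ∧ q else p ∨ q) ≢ c → p ≢ c ⊎ q ≢ c
∧∨-flips-one false false q ne = inj₂ ne
∧∨-flips-one false true  q ne = inj₁ (λ ())
∧∨-flips-one true  false q ne = inj₁ (λ ())
∧∨-flips-one true  true  q ne = inj₂ ne

one-flips-∧∨ : ∀ c p q → p ≢ c ⊎ q ≢ c → (if c then p ∧ q else p ∨ q) ≢ c
one-flips-∧∨ false true  q _         = λ ()
one-flips-∧∨ false false q (inj₁ ne) = ⊥-elim (ne refl)
one-flips-∧∨ false false q (inj₂ ne) = ne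
one-flips-∧∨ true  false q _         = λ ()
one-flips-∧∨ true  true  q (inj₁ ne) = ⊥-elim (ne refl)
one-flips-∧∨ true  true  q (inj₂ ne) = ne

module Elimination {n} (f : BN (suc n)) (v : Fin (suc n)) where

  _⊕ᵥ_ : State n → Bool → State (suc n)
  z ⊕ᵥ b = insertAt z v b

  fᵥ : State n → Bool → Bool
  fᵥ z a = lookup (f (z ⊕ᵥ a)) v

  data Decomposition : State (suc n) → Set where
    _⊕_ : ∀ z b → Decomposition (z ⊕ᵥ b)

  decompose : ∀ x → Decomposition x
  decompose x = subst Decomposition (insertAt-removeAt x v) (removeAt x v ⊕ lookup x v)

  R-⊕ : ∀ a z b → R f v a (z ⊕ᵥ b) ≡ S f v a z
  R-⊕ a z b = trans (cong (λ y → setAt (z ⊕ᵥ b) v (lookup (f y) v)) (updateAt-insertAt z v b _))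
                    (updateAt-insertAt z v b _)

  flip-v : ∀ z b → flip (z ⊕ᵥ b) v ≡ z ⊕ᵥ not b
  flip-v z b = updateAt-insertAt z v b not

  proj-flip : ∀ z b i → proj v (flip (z ⊕ᵥ b) (punchIn v i)) ≡ flip z i
  proj-flip z b i =
    trans (cong (proj v) (updateAt-insertAt-punchIn z v b i not)) (removeAt-insertAt _ v b)

  ¬PositiveLoop⇒not-identity : ¬ PositiveLoop f v → ∀ z → ¬ (fᵥ z false ≡ false × fᵥ z true ≡ true)
  ¬PositiveLoop⇒not-identity noLoop z (g₀ , g₁) = noLoop (z ⊕ᵥ false , inj₁ refl , sign≡1)
    where
    sign≡1 : + 1 ≡ signAt f (z ⊕ᵥ false) v v
    sign≡1 rewrite flip-v z false | g₀ | g₁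
                 | insertAt-lookup z v true | insertAt-lookup z v false = refl

  ¬HasEdge⇒flip-v-invariant : ∀ {j} → ¬ HasEdge f v j →
    ∀ z b → lookup (f (z ⊕ᵥ not b)) j ≡ lookup (f (z ⊕ᵥ b)) j
  ¬HasEdge⇒flip-v-invariant {j} noEdge z b =
    subst (λ y → lookup (f y) j ≡ lookup (f (z ⊕ᵥ b)) j) (flip-v z b)
          (¬HasEdge⇒flip-invariant f noEdge (z ⊕ᵥ b))

  ¬HasEdge⇒v-irrelevant : ∀ {j} → ¬ HasEdge f v j →
    ∀ z b c → lookup (f (z ⊕ᵥ b)) j ≡ lookup (f (z ⊕ᵥ c)) j
  ¬HasEdge⇒v-irrelevant noEdge z false false = refl
  ¬HasEdge⇒v-irrelevant noEdge z true  true  = refl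
  ¬HasEdge⇒v-irrelevant noEdge z false true  = sym (¬HasEdge⇒flip-v-invariant noEdge z false)
  ¬HasEdge⇒v-irrelevant noEdge z true  false = sym (¬HasEdge⇒flip-v-invariant noEdge z true)

  flips-punchIn : ∀ z b i → Flips f (z ⊕ᵥ b) (punchIn v i) →
    lookup (f (z ⊕ᵥ b)) (punchIn v i) ≢ lookup z i
  flips-punchIn z b i flips e = flips (trans e (sym (insertAt-punchIn z v b i)))

  punchIn-flips : ∀ z b i → lookup (f (z ⊕ᵥ b)) (punchIn v i) ≢ lookup z i →
    Flips f (z ⊕ᵥ b) (punchIn v i)
  punchIn-flips z b i flips e = flips (trans e (insertAt-punchIn z v b i))

  ¬HasEdge⇒flips-v-irrelevant : ∀ {i} → ¬ HasEdge f v (punchIn v i) →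
    ∀ z b c → Flips f (z ⊕ᵥ b) (punchIn v i) → Flips f (z ⊕ᵥ c) (punchIn v i)
  ¬HasEdge⇒flips-v-irrelevant {i} noEdge z b c flips = punchIn-flips z c i λ e →
    flips-punchIn z b i flips (trans (¬HasEdge⇒v-irrelevant noEdge z b c) e)

  reduced-flips : ∀ z i a → Flips f (S f v a z) (punchIn v i) → Flips (reduce f v) z i
  reduced-flips z i false flips e =
    one-flips-∧∨ _ _ _ (inj₁ (flips-punchIn z _ i flips)) (trans (sym (lookup∘tabulate _ i)) e)
  reduced-flips z i true  flips e =
    one-flips-∧∨ _ _ _ (inj₂ (flips-punchIn z _ i flips)) (trans (sym (lookup∘tabulate _ i)) e)

  reduced-flips⁻¹ : ∀ z i → Flips (reduce f v) z i →
    Σ Bool λ a → Flips f (S f v a z) (punchIn v i)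
  reduced-flips⁻¹ z i flips with ∧∨-flips-one _ _ _ (λ e → flips (trans (lookup∘tabulate _ i) e))
  ... | inj₁ flips₀ = false , punchIn-flips z _ i flips₀
  ... | inj₂ flips₁ = true  , punchIn-flips z _ i flips₁

  R-transition⇒reduced-transition : ∀ x a y i → TransIn f (R f v a x) y (punchIn v i) →
    Trans (reduce f v) (proj v x) (proj v (flip x (punchIn v i)))
  R-transition⇒reduced-transition x a y i (flips , _) with decompose x
  ... | z ⊕ b rewrite R-⊕ a z b | proj-flip z b i | removeAt-insertAt z v b =
    flips-transition (reduce f v) (reduced-flips z i a flips)

  ¬HasEdge⇒transition-preserved : ∀ x i → ¬ HasEdge f v (punchIn v i) →
    Trans f x (flip x (punchIn v i)) →
    (∀ a → Trans f (R f v a x) (flip (R f v a x) (punchIn v i)))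
    × Trans (reduce f v) (proj v x) (proj v (flip x (punchIn v i)))
  ¬HasEdge⇒transition-preserved x i noEdge t with decompose x
  ... | z ⊕ b rewrite proj-flip z b i | removeAt-insertAt z v b =
    (λ a → subst (λ y → Trans f y (flip y (punchIn v i))) (sym (R-⊕ a z b))
                 (flips-transition f (flips-at a))) ,
    flips-transition (reduce f v) (reduced-flips z i false (flips-at false))
    where
    flips-at : ∀ a → Flips f (S f v a z) (punchIn v i)
    flips-at a = ¬HasEdge⇒flips-v-irrelevant noEdge z b (fᵥ z a) (transition-flips f t)

  module _ (noLoop : ¬ PositiveLoop f v) where

    one-step-to-S : ∀ z b a → b ≡ fᵥ z a ⊎ Trans f (z ⊕ᵥ b) (S f v a z)
    one-step-to-S z b a with b ≟ fᵥ z a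
    ... | yes b≡ga = inj₁ b≡ga
    ... | no  b≢ga with flip-reaches-image (fᵥ z) (¬PositiveLoop⇒not-identity noLoop z) b a b≢ga
    ...   | gb≢b , notb≡ga =
      inj₂ (v , (λ e → gb≢b (trans e (insertAt-lookup z v b)))
              , trans (cong (z ⊕ᵥ_) (sym notb≡ga)) (sym (flip-v z b)))

    path-to-S : ∀ z b a → Path f (z ⊕ᵥ b) (S f v a z)
    path-to-S z b a with one-step-to-S z b a
    ... | inj₁ b≡ga = subst (λ c → Path f (z ⊕ᵥ b) (z ⊕ᵥ c)) b≡ga ε
    ... | inj₂ t    = t ◅ ε

    transition-to-S : ∀ z b a → z ⊕ᵥ b ≢ S f v a z → Trans f (z ⊕ᵥ b) (S f v a z)
    transition-to-S z b a ≢S with one-step-to-S z b a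
    ... | inj₁ b≡ga = ⊥-elim (≢S (cong (z ⊕ᵥ_) b≡ga))
    ... | inj₂ t    = t

    S-pair : State n → State (suc n) → Set
    S-pair z y = y ≡ S f v false z ⊎ y ≡ S f v true z

    S-in-pair : ∀ z a → S-pair z (S f v a z)
    S-in-pair z false = inj₁ refl
    S-in-pair z true  = inj₂ refl

    S-pair-connected : ∀ z a a′ → Star (TransWithin f (S-pair z)) (S f v a z) (S f v a′ z)
    S-pair-connected z a a′ with one-step-to-S z (fᵥ z a) a′
    ... | inj₁ ga≡ga′ = subst (λ c → Star _ (S f v a z) (z ⊕ᵥ c)) ga≡ga′ ε
    ... | inj₂ t      = (S-in-pair z a , S-in-pair z a′ , t) ◅ ε

    S-pair-stronglyConnected : ∀ z → StronglyConnected f (S-pair z)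
    S-pair-stronglyConnected z _ _ (inj₁ refl) (inj₁ refl) = S-pair-connected z false false
    S-pair-stronglyConnected z _ _ (inj₁ refl) (inj₂ refl) = S-pair-connected z false true
    S-pair-stronglyConnected z _ _ (inj₂ refl) (inj₁ refl) = S-pair-connected z true  false
    S-pair-stronglyConnected z _ _ (inj₂ refl) (inj₂ refl) = S-pair-connected z true  true

    transition-to-R : ∀ x → (x ≢ R f v false x ⊎ x ≢ R f v true x) →
      Trans f x (R f v false x) ⊎ Trans f x (R f v true x)
    transition-to-R x moves with decompose x
    ... | z ⊕ b rewrite R-⊕ false z b | R-⊕ true z b with moves
    ... | inj₁ ≢S₀ = inj₁ (transition-to-S z b false ≢S₀)
    ... | inj₂ ≢S₁ = inj₂ (transition-to-S z b true ≢S₁)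

    R-pair-stronglyConnected : ∀ x →
      StronglyConnected f (λ y → y ≡ R f v false x ⊎ y ≡ R f v true x)
    R-pair-stronglyConnected x with decompose x
    ... | z ⊕ b rewrite R-⊕ false z b | R-⊕ true z b = S-pair-stronglyConnected z

    reduced-transition-lifts : ∀ z i → Trans (reduce f v) z (flip z i) →
      Σ Bool λ a → Trans f (S f v a z) (flip (S f v a z) (punchIn v i))
        × (∀ y → proj v y ≡ z → Path f y (flip (S f v a z) (punchIn v i)))
    reduced-transition-lifts z i t with reduced-flips⁻¹ z i (transition-flips (reduce f v) t)
    ... | a , flips = a , flips-transition f flips , path
      where
      path : ∀ y → proj v y ≡ z → Path f y (flip (S f v a z) (punchIn v i))
      path y πy≡z with decompose y
      ... | z′ ⊕ b with trans (sym (removeAt-insertAt z′ v b)) πy≡z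
      ... | refl = path-to-S z b a ◅◅ flips-transition f flips ◅ ε

open Elimination using
  (R-transition⇒reduced-transition; ¬HasEdge⇒transition-preserved; transition-to-R;
   R-pair-stronglyConnected; reduced-transition-lifts)

lemma3p2 : ∀ {n} (f : BN (suc n)) (v : Fin (suc n)) → ¬ PositiveLoop f v →
    -- (i)
    (∀ x → (x ≢ R f v false x ⊎ x ≢ R f v true x) →
      (Trans f x (R f v false x) ⊎ Trans f x (R f v true x))
      × StronglyConnected f (λ y → (y ≡ R f v false x) ⊎ (y ≡ R f v true x)))
    -- (ii)
    × (∀ x (a : Bool) y (i : Fin n) → TransIn f (R f v a x) y (punchIn v i) →
      Trans (reduce f v) (proj v x) (proj v (flip x (punchIn v i))))
    -- (iii)
    × (∀ x (i : Fin n) → ¬ HasEdge f v (punchIn v i) →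
      Trans f x (flip x (punchIn v i)) →
      (∀ (a : Bool) → Trans f (R f v a x) (flip (R f v a x) (punchIn v i)))
      × Trans (reduce f v) (proj v x) (proj v (flip x (punchIn v i))))
    -- (iv)
    × (∀ (x : State n) (i : Fin n) → Trans (reduce f v) x (flip x i) →
      Σ Bool (λ a → Trans f (S f v a x) (flip (S f v a x) (punchIn v i))
        × (∀ y → proj v y ≡ x → Path f y (flip (S f v a x) (punchIn v i)))))
lemma3p2 f v noLoop =
  (λ x moves → transition-to-R f v noLoop x moves , R-pair-stronglyConnected f v noLoop x) ,
  R-transition⇒reduced-transition f v ,
  ¬HasEdge⇒transition-preserved f v ,
  reduced-transition-lifts f v noLoop
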